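{- Let $p,q$ be coprime positive integers and let $Q_{p,q}$ be the complete bipartite quiver with vertex set $Q_0=Q_L\sqcup Q_R$, $|Q_L|=p$, $|Q_R|=q$, having exactly one arrow from each vertex of $Q_L$ to each vertex of $Q_R$ and no other arrows. Then the canonical weight $\delta_{Q_{p,q}}$ is generic.
   Context: For a quiver $Q$ (arrow $a$ with tail $a^-$, head $a^+$), $\delta_Q(i)$ = (number of arrows with head $i$) $-$ (number of arrows with tail $i$). A subquiver $Q'$ has vertex set $Q_0$ and arrow subset $Q'_1$; $V\subseteq Q_0$ is $Q'$-successor closed if no arrow of $Q'_1$ has tail in $V$ and head outside $V$. $Q'$ is $\theta$-stable (resp. $\theta$-semistable) if $\sum_{i\in V}\theta(i)>0$ (resp. $\ge0$) for every nonempty proper $Q'$-successor closed $V\subset Q_0$. A weight $\theta$ is generic if every $\theta$-semistable subquiver is $\theta$-stable. -}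

module Defs where

open import Data.Nat using (ℕ; zero; suc)
import Data.Nat as ℕ
open import Data.Integer using (ℤ; +_; _+_; _-_; _>_; _≥_; 0ℤ)
open import Data.Fin using (Fin; zero; suc; _≟_; _↑ˡ_; _↑ʳ_; remQuot)
open import Data.Bool using (Bool; true; false; T; not; _∧_)
open import Data.Product using (Σ; _×_; _,_; proj₁; proj₂; ∃)
open import Relation.Nullary using (¬_; Dec; yes; no)
open import Relation.Nullary.Decidable using (⌊_⌋)

record Quiver : Set where
  field
    n₀   : ℕ
    n₁   : ℕ
    tail : Fin n₁ → Fin n₀
    head : Fin n₁ → Fin n₀
open Quiver public

Σℤ : (k : ℕ) → (Fin k → ℤ) → ℤ
Σℤ zero    f = 0ℤ
Σℤ (suc k) f = f zero + Σℤ k (λ i → f (suc i))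

𝟙 : Bool → ℤ
𝟙 true  = + 1
𝟙 false = 0ℤ

Weight : Quiver → Set
Weight Q = Fin (n₀ Q) → ℤ

δ : (Q : Quiver) → Weight Q
δ Q i = Σℤ (n₁ Q) (λ a → 𝟙 ⌊ head Q a ≟ i ⌋)
      - Σℤ (n₁ Q) (λ a → 𝟙 ⌊ tail Q a ≟ i ⌋)

-- A subquiver: all vertices, arrows given by a subset of Q₁.
Subquiver : Quiver → Set
Subquiver Q = Fin (n₁ Q) → Bool

VSet : Quiver → Set
VSet Q = Fin (n₀ Q) → Bool

SuccClosed : (Q : Quiver) → Subquiver Q → VSet Q → Set
SuccClosed Q Q' V = (a : Fin (n₁ Q)) → T (Q' a) → T (V (tail Q a)) → T (V (head Q a))

Nonempty : (Q : Quiver) → VSet Q → Set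
Nonempty Q V = ∃ λ i → T (V i)

Proper : (Q : Quiver) → VSet Q → Set
Proper Q V = ∃ λ i → T (not (V i))

θ[_] : {Q : Quiver} → Weight Q → VSet Q → ℤ
θ[_] {Q} θ V = Σℤ (n₀ Q) (λ i → if V i then θ i else 0ℤ)
  where open import Data.Bool using (if_then_else_)

Stable : (Q : Quiver) → Weight Q → Subquiver Q → Set
Stable Q θ Q' = (V : VSet Q) → Nonempty Q V → Proper Q V → SuccClosed Q Q' V →
  θ[_] {Q} θ V > 0ℤ

Semistable : (Q : Quiver) → Weight Q → Subquiver Q → Set
Semistable Q θ Q' = (V : VSet Q) → Nonempty Q V → Proper Q V → SuccClosed Q Q' V →
  θ[_] {Q} θ V ≥ 0ℤ

Generic : (Q : Quiver) → Weight Q → Set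
Generic Q θ = (Q' : Subquiver Q) → Semistable Q θ Q' → Stable Q θ Q'

-- Complete bipartite quiver Q_{p,q}: vertices Fin (p + q), Q_L = first p, Q_R = last q;
-- arrows Fin (p * q), arrow ↔ (l , r) ∈ Fin p × Fin q, from l to r.
Kpq : ℕ → ℕ → Quiver
Kpq p q = record
  { n₀   = p ℕ.+ q
  ; n₁   = p ℕ.* q
  ; tail = λ a → proj₁ (remQuot {p} q a) ↑ˡ q
  ; head = λ a → p ↑ʳ proj₂ (remQuot {p} q a)
  }

{-# OPTIONS --safe #-}
module Submission where

-- For every vertex set V, the canonical weight δ(V) is the number of arrows entering V minus
-- the number leaving it. In Q_{p,q}, if V contains a vertices of Q_L and b of Q_R, this is
-- pb − qa. Were it zero, coprimality would give p ∣ a with 0 ≤ a ≤ p, so V would be empty or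
-- all of Q₀. Hence δ(V) ≠ 0 for every nonempty proper V, whatever the subquiver, and
-- semistability is automatically stability.

open import Defs
open import Data.Nat using (ℕ; zero; suc; NonZero; _≤_)
import Data.Nat as ℕ
import Data.Nat.Properties as ℕ
open import Data.Nat.Coprimality using (Coprime; coprime-divisor)
open import Data.Nat.Divisibility using (_∣_; divides; ∣⇒≤)
open import Data.Integer using (ℤ; +_; _+_; _-_; _*_; -_; 0ℤ)
import Data.Integer.Properties as ℤ
open import Data.Fin using (Fin; zero; suc; _≟_; _↑ˡ_; _↑ʳ_; remQuot; combine)
open import Data.Fin.Properties using (remQuot-combine)
open import Data.Bool using (Bool; true; false; T; not; if_then_else_)
open import Data.Bool.Properties using (if-eta; if-float)
open import Data.Product using (_,_; proj₁; proj₂; _×_)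
open import Data.Sum using (inj₁; inj₂; _⊎_)
open import Data.Vec.Functional using (Vector)
open import Function using (_∘_)
open import Relation.Nullary.Decidable using (⌊_⌋; yes; no)
open import Relation.Binary.PropositionalEquality
open import Algebra.Properties.CommutativeMonoid.Sum ℤ.+-0-commutativeMonoid
  using (sum; sum-cong-≗; ∑-distrib-+; ∑-comm; sum-replicate-zero)
open import Algebra.Properties.Semiring.Sum ℤ.+-*-semiring using (*-distribˡ-sum)

Σℤ≡sum : ∀ n (f : Vector ℤ n) → Σℤ n f ≡ sum f
Σℤ≡sum zero    f = refl
Σℤ≡sum (suc n) f = cong (_+_ (f zero)) (Σℤ≡sum n (f ∘ suc))

neg-distrib-sum : ∀ {n} (f : Vector ℤ n) → - sum f ≡ sum (-_ ∘ f)
neg-distrib-sum {zero}  f = refl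
neg-distrib-sum {suc n} f =
  trans (ℤ.neg-distrib-+ (f zero) (sum (f ∘ suc)))
        (cong (_+_ (- f zero)) (neg-distrib-sum (f ∘ suc)))

∑-distrib-- : ∀ {n} (f g : Vector ℤ n) → sum (λ i → f i - g i) ≡ sum f - sum g
∑-distrib-- f g = trans (∑-distrib-+ f (-_ ∘ g)) (cong (_+_ (sum f)) (sym (neg-distrib-sum g)))

sum-const : ∀ n x → sum {n} (λ _ → x) ≡ + n * x
sum-const zero    x = sym (ℤ.*-zeroˡ x)
sum-const (suc n) x = begin
  x + sum {n} (λ _ → x)  ≡⟨ cong (_+_ x) (sum-const n x) ⟩
  x + + n * x            ≡⟨ cong (_+ + n * x) (ℤ.*-identityˡ x) ⟨
  + 1 * x + + n * x      ≡⟨ ℤ.*-distribʳ-+ x (+ 1) (+ n) ⟨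
  + suc n * x            ∎
  where open ≡-Reasoning

sum-↑ : ∀ m {n} (f : Vector ℤ (m ℕ.+ n)) →
  sum f ≡ sum (f ∘ (_↑ˡ n)) + sum (f ∘ (m ↑ʳ_))
sum-↑ zero    f = sym (ℤ.+-identityˡ (sum f))
sum-↑ (suc m) f = trans (cong (_+_ (f zero)) (sum-↑ m (f ∘ suc))) (sym (ℤ.+-assoc (f zero) _ _))

sum-combine : ∀ m {n} (f : Vector ℤ (m ℕ.* n)) →
  sum f ≡ sum (λ (i : Fin m) → sum (λ (j : Fin n) → f (combine i j)))
sum-combine zero    f = refl
sum-combine (suc m) {n} f =
  trans (sum-↑ n f)
        (cong (_+_ (sum (λ (j : Fin n) → f (combine {suc m} zero j)))) (sum-combine m (f ∘ (n ↑ʳ_))))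

sum-remQuot : ∀ m n (g : Fin m → Fin n → ℤ) →
  sum (λ a → g (proj₁ (remQuot {m} n a)) (proj₂ (remQuot {m} n a)))
    ≡ sum (λ i → sum (λ j → g i j))
sum-remQuot m n g =
  trans (sum-combine m (λ a → g (proj₁ (remQuot {m} n a)) (proj₂ (remQuot {m} n a))))
        (sum-cong-≗ λ i → sum-cong-≗ λ j →
           cong (λ ij → g (proj₁ ij) (proj₂ ij)) (remQuot-combine {m} i j))

if-distrib-sum : ∀ b {n} (f : Vector ℤ n) →
  (if b then sum f else 0ℤ) ≡ sum (λ i → if b then f i else 0ℤ)
if-distrib-sum true  f = refl
if-distrib-sum false {n} f = sym (sum-replicate-zero n)

if-distrib-- : ∀ b x y → (if b then x - y else 0ℤ) ≡ (if b then x else 0ℤ) - (if b then y else 0ℤ)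
if-distrib-- true  x y = refl
if-distrib-- false x y = refl

-- Not provable by refl: Fin's _≟_ does not reduce on suc j ≟ suc i for variable j, i.
⌊suc≟suc⌋ : ∀ {n} (j i : Fin n) → ⌊ suc j ≟ suc i ⌋ ≡ ⌊ j ≟ i ⌋
⌊suc≟suc⌋ j i with j ≟ i
... | yes _ = refl
... | no  _ = refl

𝟙≡if : ∀ b → 𝟙 b ≡ (if b then + 1 else 0ℤ)
𝟙≡if true  = refl
𝟙≡if false = refl

sum-if-≟ : ∀ {n} (V : Fin n → Bool) (j : Fin n) →
  sum (λ i → if V i then 𝟙 ⌊ j ≟ i ⌋ else 0ℤ) ≡ 𝟙 (V j)
sum-if-≟ {suc n} V zero = begin
  (if V zero then + 1 else 0ℤ) + sum (λ i → if V (suc i) then 0ℤ else 0ℤ)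
    ≡⟨ cong (_+_ (if V zero then + 1 else 0ℤ))
            (trans (sum-cong-≗ (λ i → if-eta (V (suc i)))) (sum-replicate-zero n)) ⟩
  (if V zero then + 1 else 0ℤ) + 0ℤ
    ≡⟨ ℤ.+-identityʳ _ ⟩
  (if V zero then + 1 else 0ℤ)
    ≡⟨ 𝟙≡if (V zero) ⟨
  𝟙 (V zero) ∎
  where open ≡-Reasoning
sum-if-≟ {suc n} V (suc j) = begin
  (if V zero then 0ℤ else 0ℤ) + sum (λ i → if V (suc i) then 𝟙 ⌊ suc j ≟ suc i ⌋ else 0ℤ)
    ≡⟨ cong₂ _+_ (if-eta (V zero))
                 (sum-cong-≗ λ i → cong (λ b → if V (suc i) then 𝟙 b else 0ℤ) (⌊suc≟suc⌋ j i)) ⟩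
  0ℤ + sum (λ i → if V (suc i) then 𝟙 ⌊ j ≟ i ⌋ else 0ℤ)
    ≡⟨ ℤ.+-identityˡ _ ⟩
  sum (λ i → if V (suc i) then 𝟙 ⌊ j ≟ i ⌋ else 0ℤ)
    ≡⟨ sum-if-≟ (V ∘ suc) j ⟩
  𝟙 (V (suc j)) ∎
  where open ≡-Reasoning

sum-if-fibre : ∀ {m n} (V : Fin n → Bool) (g : Fin m → Fin n) →
  sum (λ i → if V i then sum (λ a → 𝟙 ⌊ g a ≟ i ⌋) else 0ℤ) ≡ sum (λ a → 𝟙 (V (g a)))
sum-if-fibre V g = begin
  sum (λ i → if V i then sum (λ a → 𝟙 ⌊ g a ≟ i ⌋) else 0ℤ)
    ≡⟨ sum-cong-≗ (λ i → if-distrib-sum (V i) (λ a → 𝟙 ⌊ g a ≟ i ⌋)) ⟩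
  sum (λ i → sum (λ a → if V i then 𝟙 ⌊ g a ≟ i ⌋ else 0ℤ))
    ≡⟨ ∑-comm (λ i a → if V i then 𝟙 ⌊ g a ≟ i ⌋ else 0ℤ) ⟩
  sum (λ a → sum (λ i → if V i then 𝟙 ⌊ g a ≟ i ⌋ else 0ℤ))
    ≡⟨ sum-cong-≗ (λ a → sum-if-≟ V (g a)) ⟩
  sum (λ a → 𝟙 (V (g a))) ∎
  where open ≡-Reasoning

θ[δ]≡entering-leaving : ∀ Q (V : VSet Q) →
  θ[_] {Q} (δ Q) V ≡ sum (λ a → 𝟙 (V (head Q a))) - sum (λ a → 𝟙 (V (tail Q a)))
θ[δ]≡entering-leaving Q V = begin
  θ[_] {Q} (δ Q) V
    ≡⟨ Σℤ≡sum (n₀ Q) _ ⟩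
  sum (λ i → if V i then δ Q i else 0ℤ)
    ≡⟨ sum-cong-≗ (λ i → cong (λ x → if V i then x else 0ℤ) (δ≡entering-leaving i)) ⟩
  sum (λ i → if V i then entering i - leaving i else 0ℤ)
    ≡⟨ sum-cong-≗ (λ i → if-distrib-- (V i) (entering i) (leaving i)) ⟩
  sum (λ i → (if V i then entering i else 0ℤ) - (if V i then leaving i else 0ℤ))
    ≡⟨ ∑-distrib-- (λ i → if V i then entering i else 0ℤ) (λ i → if V i then leaving i else 0ℤ) ⟩
  sum (λ i → if V i then entering i else 0ℤ) - sum (λ i → if V i then leaving i else 0ℤ)
    ≡⟨ cong₂ _-_ (sum-if-fibre V (head Q)) (sum-if-fibre V (tail Q)) ⟩
  sum (λ a → 𝟙 (V (head Q a))) - sum (λ a → 𝟙 (V (tail Q a))) ∎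
  where
  open ≡-Reasoning
  entering leaving : Fin (n₀ Q) → ℤ
  entering i = sum (λ a → 𝟙 ⌊ head Q a ≟ i ⌋)
  leaving  i = sum (λ a → 𝟙 ⌊ tail Q a ≟ i ⌋)
  δ≡entering-leaving : ∀ i → δ Q i ≡ entering i - leaving i
  δ≡entering-leaving i = cong₂ _-_ (Σℤ≡sum (n₁ Q) _) (Σℤ≡sum (n₁ Q) _)

count : ∀ {n} → (Fin n → Bool) → ℕ
count {zero}  f = 0
count {suc n} f = (if f zero then 1 else 0) ℕ.+ count (f ∘ suc)

sum-𝟙≡count : ∀ {n} (f : Fin n → Bool) → sum (λ i → 𝟙 (f i)) ≡ + count f
sum-𝟙≡count {zero}  f = refl
sum-𝟙≡count {suc n} f = begin
  𝟙 (f zero) + sum (λ i → 𝟙 (f (suc i)))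
    ≡⟨ cong₂ _+_ (trans (𝟙≡if (f zero)) (sym (if-float +_ (f zero)))) (sum-𝟙≡count (f ∘ suc)) ⟩
  + (if f zero then 1 else 0) + + count (f ∘ suc)
    ≡⟨ ℤ.pos-+ (if f zero then 1 else 0) (count (f ∘ suc)) ⟨
  + count f ∎
  where open ≡-Reasoning

count≤n : ∀ {n} (f : Fin n → Bool) → count f ≤ n
count≤n {zero}  f = ℕ.z≤n
count≤n {suc n} f with f zero
... | true  = ℕ.s≤s (count≤n (f ∘ suc))
... | false = ℕ.m≤n⇒m≤1+n (count≤n (f ∘ suc))

count-↑ : ∀ m {n} (f : Fin (m ℕ.+ n) → Bool) →
  count f ≡ count (f ∘ (_↑ˡ n)) ℕ.+ count (f ∘ (m ↑ʳ_))
count-↑ zero    f = refl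
count-↑ (suc m) f =
  trans (cong ((if f zero then 1 else 0) ℕ.+_) (count-↑ m (f ∘ suc)))
        (sym (ℕ.+-assoc (if f zero then 1 else 0) _ _))

T⇒0<count : ∀ {n} (f : Fin n → Bool) {i} → T (f i) → 0 ℕ.< count f
T⇒0<count f {zero} t with f zero
... | true = ℕ.s≤s ℕ.z≤n
T⇒0<count f {suc i} t =
  ℕ.<-≤-trans (T⇒0<count (f ∘ suc) t) (ℕ.m≤n+m (count (f ∘ suc)) (if f zero then 1 else 0))

T-not⇒count<n : ∀ {n} (f : Fin n → Bool) {i} → T (not (f i)) → count f ℕ.< n
T-not⇒count<n f {zero} t with f zero
... | false = ℕ.s≤s (count≤n (f ∘ suc))
T-not⇒count<n f {suc i} t with f zero
... | true  = ℕ.s≤s (T-not⇒count<n (f ∘ suc) t)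
... | false = ℕ.m≤n⇒m≤1+n (T-not⇒count<n (f ∘ suc) t)

∣∧≤⇒≡0⊎≡ : ∀ {p a} → p ∣ a → a ≤ p → a ≡ 0 ⊎ a ≡ p
∣∧≤⇒≡0⊎≡ {a = a} p∣a a≤p with a ℕ.≟ 0
... | yes a≡0 = inj₁ a≡0
... | no  a≢0 = inj₂ (ℕ.≤-antisym a≤p (∣⇒≤ {{ℕ.≢-nonZero a≢0}} p∣a))

coprime-balance : ∀ {p q a b} .{{_ : NonZero p}} → Coprime p q → a ≤ p →
  p ℕ.* b ≡ q ℕ.* a → (a ≡ 0 × b ≡ 0) ⊎ (a ≡ p × b ≡ q)
coprime-balance {p} {q} {a} {b} coprime a≤p pb≡qa
  with ∣∧≤⇒≡0⊎≡ (coprime-divisor coprime (divides b (trans (sym pb≡qa) (ℕ.*-comm p b)))) a≤p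
... | inj₁ refl = inj₁ (refl , ℕ.m*n≡0⇒m≡0 b p (trans (ℕ.*-comm b p) (trans pb≡qa (ℕ.*-zeroʳ q))))
... | inj₂ refl = inj₂ (refl , ℕ.*-cancelˡ-≡ b q p (trans pb≡qa (ℕ.*-comm q p)))

θ[δ]-Kpq : ∀ p q (V : VSet (Kpq p q)) →
  θ[_] {Kpq p q} (δ (Kpq p q)) V
    ≡ + (p ℕ.* count (V ∘ (p ↑ʳ_))) - + (q ℕ.* count (V ∘ (_↑ˡ q)))
θ[δ]-Kpq p q V = trans (θ[δ]≡entering-leaving (Kpq p q) V) (cong₂ _-_ entering leaving)
  where
  open ≡-Reasoning
  entering : sum (λ a → 𝟙 (V (head (Kpq p q) a))) ≡ + (p ℕ.* count (V ∘ (p ↑ʳ_)))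
  entering = begin
    sum (λ a → 𝟙 (V (head (Kpq p q) a)))           ≡⟨ sum-remQuot p q (λ _ r → 𝟙 (V (p ↑ʳ r))) ⟩
    sum {p} (λ _ → sum (λ r → 𝟙 (V (p ↑ʳ r))))     ≡⟨ sum-const p (sum (λ r → 𝟙 (V (p ↑ʳ r)))) ⟩
    + p * sum (λ r → 𝟙 (V (p ↑ʳ r)))               ≡⟨ cong (+ p *_) (sum-𝟙≡count (V ∘ (p ↑ʳ_))) ⟩
    + p * + count (V ∘ (p ↑ʳ_))                    ≡⟨ ℤ.pos-* p _ ⟨
    + (p ℕ.* count (V ∘ (p ↑ʳ_)))                  ∎
  leaving : sum (λ a → 𝟙 (V (tail (Kpq p q) a))) ≡ + (q ℕ.* count (V ∘ (_↑ˡ q)))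
  leaving = begin
    sum (λ a → 𝟙 (V (tail (Kpq p q) a)))           ≡⟨ sum-remQuot p q (λ l _ → 𝟙 (V (l ↑ˡ q))) ⟩
    sum (λ l → sum {q} (λ _ → 𝟙 (V (l ↑ˡ q))))     ≡⟨ sum-cong-≗ (λ l → sum-const q (𝟙 (V (l ↑ˡ q)))) ⟩
    sum (λ l → + q * 𝟙 (V (l ↑ˡ q)))               ≡⟨ *-distribˡ-sum (+ q) (λ l → 𝟙 (V (l ↑ˡ q))) ⟨
    + q * sum (λ l → 𝟙 (V (l ↑ˡ q)))               ≡⟨ cong (+ q *_) (sum-𝟙≡count (V ∘ (_↑ˡ q))) ⟩
    + q * + count (V ∘ (_↑ˡ q))                    ≡⟨ ℤ.pos-* q _ ⟨
    + (q ℕ.* count (V ∘ (_↑ˡ q)))                  ∎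

θ[δ]-Kpq≢0 : ∀ {p q} .{{_ : NonZero p}} → Coprime p q → (V : VSet (Kpq p q)) →
  Nonempty (Kpq p q) V → Proper (Kpq p q) V → θ[_] {Kpq p q} (δ (Kpq p q)) V ≢ 0ℤ
θ[δ]-Kpq≢0 {p} {q} coprime V (i , Vi) (j , ¬Vj) θ≡0
  with coprime-balance coprime (count≤n (V ∘ (_↑ˡ q)))
         (ℤ.+-injective (ℤ.i-j≡0⇒i≡j _ _ (trans (sym (θ[δ]-Kpq p q V)) θ≡0)))
... | inj₁ (left≡0 , right≡0) =
  ℕ.<⇒≢ (T⇒0<count V Vi) (sym (trans (count-↑ p V) (cong₂ ℕ._+_ left≡0 right≡0)))
... | inj₂ (left≡p , right≡q) =
  ℕ.<⇒≢ (T-not⇒count<n V ¬Vj) (trans (count-↑ p V) (cong₂ ℕ._+_ left≡p right≡q))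

lemma3p12 : (p q : ℕ) → NonZero p → NonZero q → Coprime p q →
    Generic (Kpq p q) (δ (Kpq p q))
lemma3p12 p q p≢0 _ coprime _ semistable V nonempty proper closed =
  ℤ.≤∧≢⇒< (semistable V nonempty proper closed)
          (≢-sym (θ[δ]-Kpq≢0 {{p≢0}} coprime V nonempty proper))
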